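{- Let $\Omega$ be a finite set of size $D$ and $x_0\in 2^\Omega$. The actions of $A$ and $B$ on the $\mathcal H$-module $\mathbb C^{2^\Omega}(x_0)$ are given, for all $x\in2^\Omega$, by $$Ax=\left(\frac D4-\frac{|x_0\setminus x|+|x\setminus x_0|}{2}\right)x,\qquad Bx=\left(\frac D2+\frac{(D-2|x|)^2}{4}\right)x+\sum_y y,$$ where the last sum is over all $y\in2^\Omega$ with $|y|=|x|$ and $|x\cap y|=|x|-1$.
   Context: All algebras are unital associative over $\mathbb C$. $U(\mathfrak{sl}_2)$ is generated by $E,F,H$ with $[H,E]=2E$, $[H,F]=-2F$, $[E,F]=H$; $\Lambda=EF+FE+\frac{H^2}{2}$; $\Delta$ is the algebra homomorphism $U(\mathfrak{sl}_2)\to U(\mathfrak{sl}_2)^{\otimes2}$, $\Delta(X)=X\otimes1+1\otimes X$ ($X=E,F,H$). The universal Hahn algebra $\mathcal H$ is generated by $A,B,C$ with $[A,B]=C$ and each of $[C,A]+2A^2+B$, $[B,C]+4BA+2C$ central. $\natural:\mathcal H\to U(\mathfrak{sl}_2)^{\otimes 2}$ is the algebra homomorphism $A\mapsto\frac{H\otimes1-1\otimes H}{4}$, $B\mapsto\frac{\Delta(\Lambda)}2$, $C\mapsto E\otimes F-F\otimes E$; $U(\mathfrak{sl}_2)^{\otimes2}$-modules are $\mathcal H$-modules via $\natural$. For a finite set $S$, $\mathbb C^{2^S}$ has basis $2^S$ and is a $U(\mathfrak{sl}_2)$-module via $Ex=\sum_{y\subseteq x,|y|=|x|-1}y$, $Fx=\sum_{y\supseteq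 x,|y|=|x|+1}y$, $Hx=(|S|-2|x|)x$. Via the linear isomorphism $\iota(x_0):\mathbb C^{2^\Omega}\to\mathbb C^{2^{\Omega\setminus x_0}}\otimes\mathbb C^{2^{x_0}}$, $x\mapsto(x\setminus x_0)\otimes(x\cap x_0)$, $\mathbb C^{2^\Omega}$ becomes a $U(\mathfrak{sl}_2)^{\otimes2}$-module, hence an $\mathcal H$-module, denoted $\mathbb C^{2^\Omega}(x_0)$. -}

module Defs where

open import Data.Nat as ℕ using (ℕ; zero; suc)
open import Data.Integer as ℤ using (ℤ; +_)
open import Data.Rational as ℚ using (ℚ; _+_; _*_; _-_; _/_; 0ℚ; 1ℚ)
open import Data.Bool using (Bool; true; false)
open import Data.Bool.Properties using () renaming (_≟_ to _≟ᵇ_)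
open import Data.Vec using (Vec; []; _∷_)
open import Data.Vec.Properties using (≡-dec)
open import Data.Fin.Subset using (Subset; _⊆_; ∣_∣; _∩_; _∪_; _─_; ∁)
open import Data.Fin.Subset.Properties using (_⊆?_)
open import Data.List using (List; []; _∷_; _++_; map; concatMap; filter; foldr)
open import Data.Product using (_×_; _,_)
open import Relation.Nullary using (yes; no)
open import Relation.Nullary.Decidable using (_×-dec_)

ℕ→ℚ : ℕ → ℚ
ℕ→ℚ n = + n / 1

LC : Set → Set
LC B = List (ℚ × B)

basis : {B : Set} → B → LC B
basis b = (1ℚ , b) ∷ []

scale : {B : Set} → ℚ → LC B → LC B
scale c = map (λ { (d , b) → (c * d , b) })

bind : {B C : Set} → (B → LC C) → LC B → LC C
bind f = concatMap (λ { (c , b) → scale c (f b) })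

mapBasis : {B C : Set} → (B → C) → LC B → LC C
mapBasis f = map (λ { (c , b) → (c , f b) })

coeff : {n : ℕ} → LC (Subset n) → Subset n → ℚ
coeff [] y = 0ℚ
coeff ((c , b) ∷ l) y with ≡-dec _≟ᵇ_ b y
... | yes _ = c + coeff l y
... | no  _ = coeff l y

sumBasis : {B : Set} → List B → LC B
sumBasis = map (λ b → (1ℚ , b))

-- Linear operators, given by their values on basis vectors.

Op : Set → Set
Op B = B → LC B

_⊕_ : {B : Set} → Op B → Op B → Op B
(f ⊕ g) b = f b ++ g b

_·_ : {B : Set} → ℚ → Op B → Op B
(c · f) b = scale c (f b)

_∘ₒ_ : {B : Set} → Op B → Op B → Op B
(f ∘ₒ g) b = bind f (g b)

infixl 6 _⊕_
infixl 7 _·_ _∘ₒ_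

allSubsets : (n : ℕ) → List (Subset n)
allSubsets zero = [] ∷ []
allSubsets (suc n) = map (true ∷_) (allSubsets n) ++ map (false ∷_) (allSubsets n)

-- The U(sl₂)-module ℂ^{2^S} for a finite set S, realised as a subset
-- S ⊆ Fin D; its basis 2^S consists of the subsets x ⊆ S of Fin D.

module SL2 {D : ℕ} (S : Subset D) where

  Eₛ : Op (Subset D)
  Eₛ x = sumBasis (filter (λ y → (y ⊆? x) ×-dec (suc ∣ y ∣ ℕ.≟ ∣ x ∣)) (allSubsets D))

  Fₛ : Op (Subset D)
  Fₛ x = sumBasis (filter (λ y → (y ⊆? S) ×-dec ((x ⊆? y) ×-dec (∣ y ∣ ℕ.≟ suc ∣ x ∣)))
                          (allSubsets D))

  Hₛ : Op (Subset D)
  Hₛ x = ((ℕ→ℚ ∣ S ∣ - ℕ→ℚ (2 ℕ.* ∣ x ∣)) , x) ∷ []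

_⊗1 : {B₁ B₂ : Set} → Op B₁ → Op (B₁ × B₂)
(f ⊗1) (u , w) = mapBasis (λ u' → (u' , w)) (f u)

1⊗_ : {B₁ B₂ : Set} → Op B₂ → Op (B₁ × B₂)
(1⊗ g) (u , w) = mapBasis (λ w' → (u , w')) (g w)

-- The U(sl₂)^{⊗2}-module ℂ^{2^{Ω∖x₀}} ⊗ ℂ^{2^{x₀}}  (Ω = Fin D) and the
-- action of ♮(A), ♮(B) on it.

module Hahn {D : ℕ} (x₀ : Subset D) where

  open SL2 (∁ x₀) renaming (Eₛ to E₁; Fₛ to F₁; Hₛ to H₁)
  open SL2 x₀     renaming (Eₛ to E₂; Fₛ to F₂; Hₛ to H₂)

  T : Set
  T = Subset D × Subset D

  ΔE ΔF ΔH : Op T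
  ΔE = (E₁ ⊗1) ⊕ (1⊗ E₂)
  ΔF = (F₁ ⊗1) ⊕ (1⊗ F₂)
  ΔH = (H₁ ⊗1) ⊕ (1⊗ H₂)

  ♮A : Op T
  ♮A = (+ 1 / 4) · ((H₁ ⊗1) ⊕ (ℚ.- 1ℚ) · (1⊗ H₂))

  ♮B : Op T
  ♮B = (+ 1 / 2) · (ΔE ∘ₒ ΔF ⊕ ΔF ∘ₒ ΔE ⊕ (+ 1 / 2) · (ΔH ∘ₒ ΔH))

  ι : Subset D → T
  ι x = (x ─ x₀ , x ∩ x₀)

  ι⁻¹ : T → Subset D
  ι⁻¹ (u , w) = u ∪ w

  transport : Op T → Op (Subset D)
  transport f x = mapBasis ι⁻¹ (f (ι x))

  actA actB : Op (Subset D)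
  actA = transport ♮A
  actB = transport ♮B

-- Under ι, 2^Ω is the product 2^(Ω∖x₀) × 2^x₀, and a cover y ⋖ z in 2^Ω (y ⊆ z, |z| = |y| + 1) is a
-- cover in exactly one factor with equality in the other. Hence Δ(E) and Δ(F) act on ℂ^{2^Ω}(x₀) as
-- the down- and up-operators of 2^Ω, while H ⊗ 1 and 1 ⊗ H act diagonally; this gives A.
-- For B = Δ(Λ)/2, the (x, y) entries of EF and FE count the common upper, resp. lower, covers of x
-- and y: there are D − |x|, resp. |x|, of them when y = x, and otherwise at most one (x ∪ y, resp.
-- x ∩ y), which exists exactly when |y| = |x| and |x ∩ y| = |x| − 1.

module Submission where

open import Defs
open import Data.Bool using (Bool)
open import Data.Bool.Properties using () renaming (_≟_ to _≟ᵇ_)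
open import Data.Fin.Subset using (Subset; _⊆_; ∣_∣; _∩_; _∪_; _─_; ∁; inside; outside)
open import Data.Fin.Subset.Properties
  using ( _⊆?_; ⊆-refl; ⊆-reflexive; ⊆-trans; drop-∷-⊆; s⊆s; out⊆; p⊆q⇒∣p∣≤∣q∣
        ; p⊆p∪q; q⊆p∪q; p∩q⊆p; p∩q⊆q; x∈p∪q⁻; x∈p∩q⁺; x∈p∩q⁻; p─q⊆p; x∈p∧x∉q⇒x∈p─q
        ; x∈∁p⇒x∉p; ∣∁p∣≡n∸∣p∣; ∣p∣≤n; ∩-idem; ∩-comm)
import Data.Integer as ℤ
import Data.Integer.Properties as ℤ
import Data.Nat.Coprimality as Coprime
open import Data.List using (List; []; _∷_; _++_; map; filter)
open import Data.List.Relation.Unary.All as All using (All; []; _∷_)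
open import Data.List.Relation.Unary.All.Properties using (all-filter; map⁺; ++⁺)
open import Data.Nat as ℕ using (ℕ; zero; suc; s≤s)
import Data.Nat.Properties as ℕ
open import Data.Product using (_×_; _,_; proj₁; proj₂)
open import Data.Rational using (ℚ; mkℚ; _+_; _-_; _*_; _/_; 0ℚ; 1ℚ; -_; ½)
open import Data.Rational.Properties
  using ( +-identityˡ; +-identityʳ; *-identityˡ; *-identityʳ; *-zeroˡ; *-zeroʳ
        ; +-assoc; *-assoc; *-comm; *-distribˡ-+; *-distribʳ-+; normalize-coprime; /-cong)
open import Data.Rational.Solver using (module +-*-Solver)
open import Data.Empty using (⊥-elim)
open import Data.Sum as Sum using (_⊎_; inj₁; inj₂)
open import Data.Vec using ([]; _∷_; here; there)
open import Data.Vec.Properties using (≡-dec; ∷-injectiveˡ; ∷-injectiveʳ)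
open import Function using (_∘_)
open import Level using (Level)
open import Relation.Nullary using (Dec; yes; no; ¬_; contradiction)
open import Relation.Nullary.Decidable using (_×-dec_)
open import Relation.Unary using (Decidable)
open import Relation.Binary.PropositionalEquality

open +-*-Solver using (solve; _:=_; _:+_; _:-_; _:*_; con)

private
  variable
    ℓ₁ ℓ₂ ℓ₃ : Level
    A : Set ℓ₁
    B : Set ℓ₂
    C : Set ℓ₃
    n : ℕ
    X Y : Set

-- ℕ and ℤ inside ℚ

/1≡mkℚ : ∀ i → i / 1 ≡ mkℚ i 0 (Coprime.sym (Coprime.1-coprimeTo ℤ.∣ i ∣))
/1≡mkℚ (ℤ.+ k)    = normalize-coprime (Coprime.sym (Coprime.1-coprimeTo k))
/1≡mkℚ ℤ.-[1+ k ] = cong -_ (normalize-coprime (Coprime.sym (Coprime.1-coprimeTo (suc k))))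

/1-distrib-+ : ∀ i j → (i ℤ.+ j) / 1 ≡ i / 1 + j / 1
/1-distrib-+ i j = trans
  (/-cong {i ℤ.+ j} {1} {i ℤ.* ℤ.+ 1 ℤ.+ j ℤ.* ℤ.+ 1} {1}
          (cong₂ ℤ._+_ (sym (ℤ.*-identityʳ i)) (sym (ℤ.*-identityʳ j))) refl)
  (sym (cong₂ _+_ (/1≡mkℚ i) (/1≡mkℚ j)))

neg-/1 : ∀ k → (ℤ.- ℤ.+ k) / 1 ≡ - ℕ→ℚ k
neg-/1 zero    = refl
neg-/1 (suc k) = refl

ℕ→ℚ-+ : ∀ m k → ℕ→ℚ (m ℕ.+ k) ≡ ℕ→ℚ m + ℕ→ℚ k
ℕ→ℚ-+ m k = /1-distrib-+ (ℤ.+ m) (ℤ.+ k)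

ℕ→ℚ-2* : ∀ k → ℕ→ℚ (2 ℕ.* k) ≡ ℕ→ℚ k + ℕ→ℚ k
ℕ→ℚ-2* k = trans (cong (λ j → ℕ→ℚ (k ℕ.+ j)) (ℕ.+-identityʳ k)) (ℕ→ℚ-+ k k)

[+m-+k]/1 : ∀ m k → (ℤ.+ m ℤ.- ℤ.+ k) / 1 ≡ ℕ→ℚ m - ℕ→ℚ k
[+m-+k]/1 m k = trans (/1-distrib-+ (ℤ.+ m) (ℤ.- ℤ.+ k)) (cong (ℕ→ℚ m +_) (neg-/1 k))

-- Indicators, sums and linear extensions

𝟙 : Dec A → ℚ
𝟙 (yes _) = 1ℚ
𝟙 (no _)  = 0ℚ

𝟙-×-dec : (A? : Dec A) (B? : Dec B) → 𝟙 (A? ×-dec B?) ≡ 𝟙 A? * 𝟙 B?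
𝟙-×-dec (yes _) (yes _) = refl
𝟙-×-dec (yes _) (no _)  = refl
𝟙-×-dec (no _)  (yes _) = refl
𝟙-×-dec (no _)  (no _)  = refl

𝟙-cong : (A? : Dec A) (B? : Dec B) → (A → B) → (B → A) → 𝟙 A? ≡ 𝟙 B?
𝟙-cong (yes _) (yes _) _ _ = refl
𝟙-cong (yes a) (no ¬b) f _ = contradiction (f a) ¬b
𝟙-cong (no ¬a) (yes b) _ g = contradiction (g b) ¬a
𝟙-cong (no _)  (no _)  _ _ = refl

𝟙-yes : (A? : Dec A) → A → 𝟙 A? ≡ 1ℚ
𝟙-yes (yes _) _ = refl
𝟙-yes (no ¬a) a = contradiction a ¬a

𝟙-no : (A? : Dec A) → ¬ A → 𝟙 A? ≡ 0ℚ
𝟙-no (yes a) ¬a = contradiction a ¬a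
𝟙-no (no _)  _  = refl

𝟙-idem : (A? : Dec A) → 𝟙 A? * 𝟙 A? ≡ 𝟙 A?
𝟙-idem (yes _) = refl
𝟙-idem (no _)  = refl

𝟙-+-disjoint : (A? : Dec A) (B? : Dec B) (C? : Dec C) →
               (A → C) → (B → C) → (C → A ⊎ B) → (A → ¬ B) → 𝟙 A? + 𝟙 B? ≡ 𝟙 C?
𝟙-+-disjoint (yes a) (yes b) _       _ _ _ a⇒¬b = contradiction b (a⇒¬b a)
𝟙-+-disjoint (yes a) (no _)  C?      f _ _ _    = sym (𝟙-yes C? (f a))
𝟙-+-disjoint (no _)  (yes b) C?      _ g _ _    = sym (𝟙-yes C? (g b))
𝟙-+-disjoint (no ¬a) (no ¬b) (yes c) _ _ h _    = ⊥-elim (Sum.[ ¬a , ¬b ] (h c))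
𝟙-+-disjoint (no _)  (no _)  (no _)  _ _ _ _    = refl

-- decided as in 'coeff'
δ : Subset n → Subset n → ℚ
δ p q = 𝟙 (≡-dec _≟ᵇ_ p q)

δ-refl : (p : Subset n) → δ p p ≡ 1ℚ
δ-refl p = 𝟙-yes (≡-dec _≟ᵇ_ p p) refl

δ-≢ : {p q : Subset n} → p ≢ q → δ p q ≡ 0ℚ
δ-≢ {p = p} {q} = 𝟙-no (≡-dec _≟ᵇ_ p q)

δ-comm : (p q : Subset n) → δ p q ≡ δ q p
δ-comm p q = 𝟙-cong (≡-dec _≟ᵇ_ p q) (≡-dec _≟ᵇ_ q p) sym sym

coeff-∷ : (c : ℚ) (b : Subset n) (l : LC (Subset n)) (y : Subset n) →
          coeff ((c , b) ∷ l) y ≡ c * δ b y + coeff l y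
coeff-∷ c b l y with ≡-dec _≟ᵇ_ b y
... | yes _ = cong (_+ coeff l y) (sym (*-identityʳ c))
... | no _  = sym (trans (cong (_+ coeff l y) (*-zeroʳ c)) (+-identityˡ _))

coeff-singleton : (c : ℚ) (b y : Subset n) → coeff ((c , b) ∷ []) y ≡ c * δ b y
coeff-singleton c b y = trans (coeff-∷ c b [] y) (+-identityʳ _)

∑ : List X → (X → ℚ) → ℚ
∑ []       f = 0ℚ
∑ (b ∷ bs) f = f b + ∑ bs f

∑-++ : (L M : List X) (f : X → ℚ) → ∑ (L ++ M) f ≡ ∑ L f + ∑ M f
∑-++ []      M f = sym (+-identityˡ _)
∑-++ (b ∷ L) M f = trans (cong (f b +_) (∑-++ L M f)) (sym (+-assoc (f b) _ _))

∑-map : (g : Y → X) (L : List Y) (f : X → ℚ) → ∑ (map g L) f ≡ ∑ L (f ∘ g)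
∑-map g []      f = refl
∑-map g (c ∷ L) f = cong (f (g c) +_) (∑-map g L f)

∑-cong : (L : List X) {f g : X → ℚ} → (∀ b → f b ≡ g b) → ∑ L f ≡ ∑ L g
∑-cong []      _ = refl
∑-cong (b ∷ L) e = cong₂ _+_ (e b) (∑-cong L e)

∑-zero : (L : List X) {f : X → ℚ} → (∀ b → f b ≡ 0ℚ) → ∑ L f ≡ 0ℚ
∑-zero []      _ = refl
∑-zero (b ∷ L) e = cong₂ _+_ (e b) (∑-zero L e)

∑-+ : (L : List X) (f g : X → ℚ) → ∑ L (λ b → f b + g b) ≡ ∑ L f + ∑ L g
∑-+ []      f g = refl
∑-+ (b ∷ L) f g = trans (cong (f b + g b +_) (∑-+ L f g))
  (solve 4 (λ a b c d → (a :+ b) :+ (c :+ d) := (a :+ c) :+ (b :+ d)) refl (f b) (g b) (∑ L f) (∑ L g))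

∑-*ˡ : (L : List X) (c : ℚ) (f : X → ℚ) → ∑ L (λ b → c * f b) ≡ c * ∑ L f
∑-*ˡ []      c f = sym (*-zeroʳ c)
∑-*ˡ (b ∷ L) c f = trans (cong (c * f b +_) (∑-*ˡ L c f)) (sym (*-distribˡ-+ c (f b) (∑ L f)))

∑-filter : {P : X → Set} (P? : Decidable P) (L : List X) (f : X → ℚ) →
           ∑ (filter P? L) f ≡ ∑ L (λ b → 𝟙 (P? b) * f b)
∑-filter P? []      f = refl
∑-filter P? (b ∷ L) f with P? b
... | yes _ = cong₂ _+_ (sym (*-identityˡ (f b))) (∑-filter P? L f)
... | no _  = trans (∑-filter P? L f) (sym (trans (cong (_+ _) (*-zeroˡ (f b))) (+-identityˡ _)))

⟪_,_⟫ : LC X → (X → ℚ) → ℚ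
⟪ []          , h ⟫ = 0ℚ
⟪ (c , b) ∷ l , h ⟫ = c * h b + ⟪ l , h ⟫

⟪⟫-++ : (l m : LC X) (h : X → ℚ) → ⟪ l ++ m , h ⟫ ≡ ⟪ l , h ⟫ + ⟪ m , h ⟫
⟪⟫-++ []            m h = sym (+-identityˡ _)
⟪⟫-++ ((c , b) ∷ l) m h = trans (cong (c * h b +_) (⟪⟫-++ l m h)) (sym (+-assoc (c * h b) _ _))

⟪⟫-scale : (d : ℚ) (l : LC X) (h : X → ℚ) → ⟪ scale d l , h ⟫ ≡ d * ⟪ l , h ⟫
⟪⟫-scale d []            h = sym (*-zeroʳ d)
⟪⟫-scale d ((c , b) ∷ l) h = begin
  d * c * h b + ⟪ scale d l , h ⟫   ≡⟨ cong₂ _+_ (*-assoc d c (h b)) (⟪⟫-scale d l h) ⟩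
  d * (c * h b) + d * ⟪ l , h ⟫     ≡⟨ *-distribˡ-+ d (c * h b) ⟪ l , h ⟫ ⟨
  d * (c * h b + ⟪ l , h ⟫)         ∎
  where open ≡-Reasoning

⟪⟫-mapBasis : (f : X → Y) (l : LC X) (h : Y → ℚ) → ⟪ mapBasis f l , h ⟫ ≡ ⟪ l , h ∘ f ⟫
⟪⟫-mapBasis f []            h = refl
⟪⟫-mapBasis f ((c , b) ∷ l) h = cong (c * h (f b) +_) (⟪⟫-mapBasis f l h)

⟪⟫-bind : (g : X → LC Y) (l : LC X) (h : Y → ℚ) → ⟪ bind g l , h ⟫ ≡ ⟪ l , (λ b → ⟪ g b , h ⟫) ⟫
⟪⟫-bind g []            h = refl
⟪⟫-bind g ((c , b) ∷ l) h = trans (⟪⟫-++ (scale c (g b)) (bind g l) h)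
  (cong₂ _+_ (⟪⟫-scale c (g b) h) (⟪⟫-bind g l h))

⟪⟫-sumBasis : (L : List X) (h : X → ℚ) → ⟪ sumBasis L , h ⟫ ≡ ∑ L h
⟪⟫-sumBasis []      h = refl
⟪⟫-sumBasis (b ∷ L) h = cong₂ _+_ (*-identityˡ (h b)) (⟪⟫-sumBasis L h)

⟪⟫-cong : (l : LC X) {h g : X → ℚ} → All (λ e → h (proj₂ e) ≡ g (proj₂ e)) l → ⟪ l , h ⟫ ≡ ⟪ l , g ⟫
⟪⟫-cong []            []       = refl
⟪⟫-cong ((c , b) ∷ l) (e ∷ es) = cong₂ _+_ (cong (c *_) e) (⟪⟫-cong l es)

⟪⟫-*ʳ : (l : LC X) (h : X → ℚ) (d : ℚ) → ⟪ l , (λ b → h b * d) ⟫ ≡ ⟪ l , h ⟫ * d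
⟪⟫-*ʳ []            h d = sym (*-zeroˡ d)
⟪⟫-*ʳ ((c , b) ∷ l) h d = trans (cong₂ _+_ (sym (*-assoc c (h b) d)) (⟪⟫-*ʳ l h d))
  (sym (*-distribʳ-+ d (c * h b) ⟪ l , h ⟫))

⟪⟫-∑ : (l : LC X) (M : List Y) (k : X → Y → ℚ) →
       ⟪ l , (λ b → ∑ M (k b)) ⟫ ≡ ∑ M (λ z → ⟪ l , (λ b → k b z) ⟫)
⟪⟫-∑ []            M k = sym (∑-zero M (λ _ → refl))
⟪⟫-∑ ((c , b) ∷ l) M k = begin
  c * ∑ M (k b) + ⟪ l , (λ b → ∑ M (k b)) ⟫
    ≡⟨ cong₂ _+_ (sym (∑-*ˡ M c (k b))) (⟪⟫-∑ l M k) ⟩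
  ∑ M (λ z → c * k b z) + ∑ M (λ z → ⟪ l , (λ b → k b z) ⟫)
    ≡⟨ ∑-+ M _ _ ⟨
  ∑ M (λ z → c * k b z + ⟪ l , (λ b → k b z) ⟫) ∎
  where open ≡-Reasoning

coeff≡⟪⟫ : (l : LC (Subset n)) (y : Subset n) → coeff l y ≡ ⟪ l , (λ b → δ b y) ⟫
coeff≡⟪⟫ []            y = refl
coeff≡⟪⟫ ((c , b) ∷ l) y = trans (coeff-∷ c b l y) (cong (c * δ b y +_) (coeff≡⟪⟫ l y))

∑Subsets : (Subset n → ℚ) → ℚ
∑Subsets {n} g = ∑ (allSubsets n) g

∑Subsets-suc : (g : Subset (suc n) → ℚ) →
               ∑Subsets g ≡ ∑Subsets (g ∘ (inside ∷_)) + ∑Subsets (g ∘ (outside ∷_))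
∑Subsets-suc {n} g = trans (∑-++ (map (inside ∷_) (allSubsets n)) _ g)
  (cong₂ _+_ (∑-map (inside ∷_) (allSubsets n) g) (∑-map (outside ∷_) (allSubsets n) g))

∑Subsets-single : (g : Subset n → ℚ) (w : Subset n) → (∀ z → z ≢ w → g z ≡ 0ℚ) → ∑Subsets g ≡ g w
∑Subsets-single {zero}  g []      _ = +-identityʳ (g [])
∑Subsets-single {suc n} g (inside ∷ w) g≡0 = trans (∑Subsets-suc g) (begin
  ∑Subsets (g ∘ (inside ∷_)) + ∑Subsets (g ∘ (outside ∷_))
    ≡⟨ cong₂ _+_ (∑Subsets-single _ w (λ z z≢w → g≡0 _ (z≢w ∘ ∷-injectiveʳ)))
                 (∑-zero (allSubsets n) (λ z → g≡0 _ ((λ ()) ∘ ∷-injectiveˡ))) ⟩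
  g (inside ∷ w) + 0ℚ
    ≡⟨ +-identityʳ _ ⟩
  g (inside ∷ w) ∎)
  where open ≡-Reasoning
∑Subsets-single {suc n} g (outside ∷ w) g≡0 = trans (∑Subsets-suc g) (begin
  ∑Subsets (g ∘ (inside ∷_)) + ∑Subsets (g ∘ (outside ∷_))
    ≡⟨ cong₂ _+_ (∑-zero (allSubsets n) (λ z → g≡0 _ ((λ ()) ∘ ∷-injectiveˡ)))
                 (∑Subsets-single _ w (λ z z≢w → g≡0 _ (z≢w ∘ ∷-injectiveʳ))) ⟩
  0ℚ + g (outside ∷ w)
    ≡⟨ +-identityˡ _ ⟩
  g (outside ∷ w) ∎)
  where open ≡-Reasoning

∑Subsets-δˡ : (w : Subset n) (g : Subset n → ℚ) → ∑Subsets (λ z → δ w z * g z) ≡ g w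
∑Subsets-δˡ w g = trans
  (∑Subsets-single _ w (λ z z≢w → trans (cong (_* g z) (δ-≢ (z≢w ∘ sym))) (*-zeroˡ (g z))))
  (trans (cong (_* g w) (δ-refl w)) (*-identityˡ (g w)))

∑Subsets-δʳ : (w : Subset n) (g : Subset n → ℚ) → ∑Subsets (λ z → g z * δ z w) ≡ g w
∑Subsets-δʳ w g = trans
  (∑Subsets-single _ w (λ z z≢w → trans (cong (g z *_) (δ-≢ z≢w)) (*-zeroʳ (g z))))
  (trans (cong (g w *_) (δ-refl w)) (*-identityʳ (g w)))

∑Subsets-δ : (w : Subset n) → ∑Subsets (δ w) ≡ 1ℚ
∑Subsets-δ w = trans (∑-cong (allSubsets _) (λ z → sym (*-identityʳ (δ w z)))) (∑Subsets-δˡ w (λ _ → 1ℚ))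

∑Subsets-𝟙-unique : {P : Subset n → Set} (P? : Decidable P) (Q? : Dec A) (w : Subset n) →
                    (∀ {z} → P z → z ≡ w) → (P w → A) → (A → P w) →
                    ∑Subsets (λ z → 𝟙 (P? z)) ≡ 𝟙 Q?
∑Subsets-𝟙-unique P? Q? w unique P⇒A A⇒P = trans
  (∑Subsets-single _ w (λ z z≢w → 𝟙-no (P? z) (z≢w ∘ unique)))
  (𝟙-cong (P? w) Q? P⇒A A⇒P)

coeff-filter : {P : Subset n → Set} (P? : Decidable P) (y : Subset n) →
               coeff (sumBasis (filter P? (allSubsets n))) y ≡ 𝟙 (P? y)
coeff-filter {n} P? y = begin
  coeff (sumBasis L) y                ≡⟨ coeff≡⟪⟫ (sumBasis L) y ⟩
  ⟪ sumBasis L , (λ b → δ b y) ⟫      ≡⟨ ⟪⟫-sumBasis L _ ⟩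
  ∑ L (λ b → δ b y)                   ≡⟨ ∑-filter P? (allSubsets n) _ ⟩
  ∑Subsets (λ z → 𝟙 (P? z) * δ z y)   ≡⟨ ∑Subsets-δʳ y (𝟙 ∘ P?) ⟩
  𝟙 (P? y)                            ∎
  where
  open ≡-Reasoning
  L = filter P? (allSubsets n)

-- The Boolean lattice of subsets

p⊆q∧∣q∣≤∣p∣⇒p≡q : {p q : Subset n} → p ⊆ q → ∣ q ∣ ℕ.≤ ∣ p ∣ → p ≡ q
p⊆q∧∣q∣≤∣p∣⇒p≡q {p = []}          {[]}          _ _ = refl
p⊆q∧∣q∣≤∣p∣⇒p≡q {p = outside ∷ p} {outside ∷ q} p⊆q ∣q∣≤∣p∣ =
  cong (outside ∷_) (p⊆q∧∣q∣≤∣p∣⇒p≡q (drop-∷-⊆ p⊆q) ∣q∣≤∣p∣)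
p⊆q∧∣q∣≤∣p∣⇒p≡q {p = outside ∷ p} {inside ∷ q}  p⊆q ∣q∣<∣p∣ =
  contradiction ∣q∣<∣p∣ (ℕ.<⇒≱ (s≤s (p⊆q⇒∣p∣≤∣q∣ (drop-∷-⊆ p⊆q))))
p⊆q∧∣q∣≤∣p∣⇒p≡q {p = inside ∷ p}  {outside ∷ q} p⊆q _ = contradiction (p⊆q here) λ ()
p⊆q∧∣q∣≤∣p∣⇒p≡q {p = inside ∷ p}  {inside ∷ q}  p⊆q (s≤s ∣q∣≤∣p∣) =
  cong (inside ∷_) (p⊆q∧∣q∣≤∣p∣⇒p≡q (drop-∷-⊆ p⊆q) ∣q∣≤∣p∣)

p⊆q⇒p≡q⊎∣p∣<∣q∣ : {p q : Subset n} → p ⊆ q → p ≡ q ⊎ ∣ p ∣ ℕ.< ∣ q ∣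
p⊆q⇒p≡q⊎∣p∣<∣q∣ p⊆q with ℕ.m≤n⇒m<n∨m≡n (p⊆q⇒∣p∣≤∣q∣ p⊆q)
... | inj₁ ∣p∣<∣q∣ = inj₂ ∣p∣<∣q∣
... | inj₂ ∣p∣≡∣q∣ = inj₁ (p⊆q∧∣q∣≤∣p∣⇒p≡q p⊆q (ℕ.≤-reflexive (sym ∣p∣≡∣q∣)))

∣p∪q∣+∣p∩q∣≡∣p∣+∣q∣ : (p q : Subset n) → ∣ p ∪ q ∣ ℕ.+ ∣ p ∩ q ∣ ≡ ∣ p ∣ ℕ.+ ∣ q ∣
∣p∪q∣+∣p∩q∣≡∣p∣+∣q∣ []            []            = refl
∣p∪q∣+∣p∩q∣≡∣p∣+∣q∣ (inside ∷ p)  (inside ∷ q)  =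
  cong suc (trans (ℕ.+-suc _ _) (trans (cong suc (∣p∪q∣+∣p∩q∣≡∣p∣+∣q∣ p q)) (sym (ℕ.+-suc _ _))))
∣p∪q∣+∣p∩q∣≡∣p∣+∣q∣ (inside ∷ p)  (outside ∷ q) = cong suc (∣p∪q∣+∣p∩q∣≡∣p∣+∣q∣ p q)
∣p∪q∣+∣p∩q∣≡∣p∣+∣q∣ (outside ∷ p) (inside ∷ q)  =
  trans (cong suc (∣p∪q∣+∣p∩q∣≡∣p∣+∣q∣ p q)) (sym (ℕ.+-suc _ _))
∣p∪q∣+∣p∩q∣≡∣p∣+∣q∣ (outside ∷ p) (outside ∷ q) = ∣p∪q∣+∣p∩q∣≡∣p∣+∣q∣ p q

∪-least : {p q r : Subset n} → p ⊆ r → q ⊆ r → p ∪ q ⊆ r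
∪-least {p = p} {q} p⊆r q⊆r x∈p∪q with x∈p∪q⁻ p q x∈p∪q
... | inj₁ x∈p = p⊆r x∈p
... | inj₂ x∈q = q⊆r x∈q

∩-greatest : {p q r : Subset n} → r ⊆ p → r ⊆ q → r ⊆ p ∩ q
∩-greatest r⊆p r⊆q x∈r = x∈p∩q⁺ (r⊆p x∈r , r⊆q x∈r)

p─q⊆∁q : (p q : Subset n) → p ─ q ⊆ ∁ q
p─q⊆∁q (_ ∷ p) (inside ∷ q)  (there x∈) = there (p─q⊆∁q p q x∈)
p─q⊆∁q (_ ∷ p) (outside ∷ q) here       = here
p─q⊆∁q (_ ∷ p) (outside ∷ q) (there x∈) = there (p─q⊆∁q p q x∈)

∩-monoˡ-⊆ : {p q : Subset n} (r : Subset n) → p ⊆ q → p ∩ r ⊆ q ∩ r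
∩-monoˡ-⊆ {p = p} r p⊆q x∈p∩r with x∈p∩q⁻ p r x∈p∩r
... | x∈p , x∈r = x∈p∩q⁺ (p⊆q x∈p , x∈r)

─-monoˡ-⊆ : {p q : Subset n} (r : Subset n) → p ⊆ q → p ─ r ⊆ q ─ r
─-monoˡ-⊆ {p = p} r p⊆q x∈p─r =
  x∈p∧x∉q⇒x∈p─q (p⊆q (p─q⊆p p r x∈p─r)) (x∈∁p⇒x∉p (p─q⊆∁q p r x∈p─r))

p─q∪p∩q≡p : (p q : Subset n) → (p ─ q) ∪ (p ∩ q) ≡ p
p─q∪p∩q≡p []            []            = refl
p─q∪p∩q≡p (inside ∷ p)  (inside ∷ q)  = cong (inside ∷_) (p─q∪p∩q≡p p q)
p─q∪p∩q≡p (inside ∷ p)  (outside ∷ q) = cong (inside ∷_) (p─q∪p∩q≡p p q)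
p─q∪p∩q≡p (outside ∷ p) (inside ∷ q)  = cong (outside ∷_) (p─q∪p∩q≡p p q)
p─q∪p∩q≡p (outside ∷ p) (outside ∷ q) = cong (outside ∷_) (p─q∪p∩q≡p p q)

∣p─q∣+∣p∩q∣≡∣p∣ : (p q : Subset n) → ∣ p ─ q ∣ ℕ.+ ∣ p ∩ q ∣ ≡ ∣ p ∣
∣p─q∣+∣p∩q∣≡∣p∣ []            []            = refl
∣p─q∣+∣p∩q∣≡∣p∣ (inside ∷ p)  (inside ∷ q)  =
  trans (ℕ.+-suc _ _) (cong suc (∣p─q∣+∣p∩q∣≡∣p∣ p q))
∣p─q∣+∣p∩q∣≡∣p∣ (inside ∷ p)  (outside ∷ q) = cong suc (∣p─q∣+∣p∩q∣≡∣p∣ p q)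
∣p─q∣+∣p∩q∣≡∣p∣ (outside ∷ p) (inside ∷ q)  = ∣p─q∣+∣p∩q∣≡∣p∣ p q
∣p─q∣+∣p∩q∣≡∣p∣ (outside ∷ p) (outside ∷ q) = ∣p─q∣+∣p∩q∣≡∣p∣ p q

∣∁p∣+∣p∣≡n : (p : Subset n) → ∣ ∁ p ∣ ℕ.+ ∣ p ∣ ≡ n
∣∁p∣+∣p∣≡n p = trans (cong (ℕ._+ ∣ p ∣) (∣∁p∣≡n∸∣p∣ p)) (ℕ.m∸n+n≡m (∣p∣≤n p))

⊆-from-split : {p q : Subset n} (s : Subset n) → p ─ s ⊆ q ─ s → p ∩ s ⊆ q ∩ s → p ⊆ q
⊆-from-split {p = p} {q} s ─⊆ ∩⊆ =
  subst₂ _⊆_ (p─q∪p∩q≡p p s) (p─q∪p∩q≡p q s)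
    (∪-least (⊆-trans ─⊆ (p⊆p∪q (q ∩ s))) (⊆-trans ∩⊆ (q⊆p∪q (q ─ s) (q ∩ s))))

∪-─-cancel : {u w s : Subset n} → u ⊆ ∁ s → w ⊆ s → (u ∪ w) ─ s ≡ u
∪-─-cancel {u = []}          {[]}          {[]}          _ _ = refl
∪-─-cancel {u = inside ∷ u}  {_}           {inside ∷ s}  u⊆ _ = contradiction (u⊆ here) λ ()
∪-─-cancel {u = outside ∷ u} {_ ∷ w}       {inside ∷ s}  u⊆ w⊆ =
  cong (outside ∷_) (∪-─-cancel (drop-∷-⊆ u⊆) (drop-∷-⊆ w⊆))
∪-─-cancel {u = _}           {inside ∷ w}  {outside ∷ s} _ w⊆ = contradiction (w⊆ here) λ ()
∪-─-cancel {u = inside ∷ u}  {outside ∷ w} {outside ∷ s} u⊆ w⊆ =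
  cong (inside ∷_) (∪-─-cancel (drop-∷-⊆ u⊆) (drop-∷-⊆ w⊆))
∪-─-cancel {u = outside ∷ u} {outside ∷ w} {outside ∷ s} u⊆ w⊆ =
  cong (outside ∷_) (∪-─-cancel (drop-∷-⊆ u⊆) (drop-∷-⊆ w⊆))

∪-∩-cancel : {u w s : Subset n} → u ⊆ ∁ s → w ⊆ s → (u ∪ w) ∩ s ≡ w
∪-∩-cancel {u = []}          {[]}          {[]}          _ _ = refl
∪-∩-cancel {u = inside ∷ u}  {_}           {inside ∷ s}  u⊆ _ = contradiction (u⊆ here) λ ()
∪-∩-cancel {u = outside ∷ u} {inside ∷ w}  {inside ∷ s}  u⊆ w⊆ =
  cong (inside ∷_) (∪-∩-cancel (drop-∷-⊆ u⊆) (drop-∷-⊆ w⊆))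
∪-∩-cancel {u = outside ∷ u} {outside ∷ w} {inside ∷ s}  u⊆ w⊆ =
  cong (outside ∷_) (∪-∩-cancel (drop-∷-⊆ u⊆) (drop-∷-⊆ w⊆))
∪-∩-cancel {u = _}           {inside ∷ w}  {outside ∷ s} _ w⊆ = contradiction (w⊆ here) λ ()
∪-∩-cancel {u = inside ∷ u}  {outside ∷ w} {outside ∷ s} u⊆ w⊆ =
  cong (outside ∷_) (∪-∩-cancel (drop-∷-⊆ u⊆) (drop-∷-⊆ w⊆))
∪-∩-cancel {u = outside ∷ u} {outside ∷ w} {outside ∷ s} u⊆ w⊆ =
  cong (outside ∷_) (∪-∩-cancel (drop-∷-⊆ u⊆) (drop-∷-⊆ w⊆))

-- Covers in the Boolean lattice

+-≡suc-split : ∀ {m₁ m₂ n₁ n₂} → m₁ ℕ.≤ n₁ → m₂ ℕ.≤ n₂ → n₁ ℕ.+ n₂ ≡ suc (m₁ ℕ.+ m₂) →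
               (suc m₁ ≡ n₁ × m₂ ≡ n₂) ⊎ (m₁ ≡ n₁ × suc m₂ ≡ n₂)
+-≡suc-split {m₁} {m₂} {n₁} {n₂} m₁≤n₁ m₂≤n₂ eq with ℕ.m≤n⇒m<n∨m≡n m₁≤n₁
... | inj₂ refl  = inj₂ (refl , sym (ℕ.+-cancelˡ-≡ m₁ n₂ (suc m₂) (trans eq (sym (ℕ.+-suc m₁ m₂)))))
... | inj₁ m₁<n₁ =
  inj₁ (sym (ℕ.+-cancelʳ-≡ n₂ n₁ (suc m₁) (trans eq (cong (λ k → suc (m₁ ℕ.+ k)) m₂≡n₂))) , m₂≡n₂)
  where
  m₂≡n₂ : m₂ ≡ n₂
  m₂≡n₂ = ℕ.≤-antisym m₂≤n₂
    (ℕ.+-cancelˡ-≤ (suc m₁) n₂ m₂ (subst (suc m₁ ℕ.+ n₂ ℕ.≤_) eq (ℕ.+-monoˡ-≤ n₂ m₁<n₁)))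

infix 4 _⋖_ _⋖?_

_⋖_ : Subset n → Subset n → Set
p ⋖ q = p ⊆ q × suc ∣ p ∣ ≡ ∣ q ∣

_⋖?_ : (p q : Subset n) → Dec (p ⋖ q)
p ⋖? q = (p ⊆? q) ×-dec (suc ∣ p ∣ ℕ.≟ ∣ q ∣)

⋖-irrefl : {p : Subset n} → ¬ p ⋖ p
⋖-irrefl (_ , e) = ℕ.1+n≢n e

module _ (s : Subset n) {p q : Subset n} where

  ⋖-from-─ : p ─ s ⋖ q ─ s → p ∩ s ≡ q ∩ s → p ⋖ q
  ⋖-from-─ (⊆─ , e─) e∩ = ⊆-from-split s ⊆─ (⊆-reflexive e∩) , (begin
    suc ∣ p ∣                       ≡⟨ cong suc (∣p─q∣+∣p∩q∣≡∣p∣ p s) ⟨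
    suc (∣ p ─ s ∣ ℕ.+ ∣ p ∩ s ∣)   ≡⟨ cong₂ ℕ._+_ e─ (cong ∣_∣ e∩) ⟩
    ∣ q ─ s ∣ ℕ.+ ∣ q ∩ s ∣         ≡⟨ ∣p─q∣+∣p∩q∣≡∣p∣ q s ⟩
    ∣ q ∣                           ∎)
    where open ≡-Reasoning

  ⋖-from-∩ : p ∩ s ⋖ q ∩ s → p ─ s ≡ q ─ s → p ⋖ q
  ⋖-from-∩ (⊆∩ , e∩) e─ = ⊆-from-split s (⊆-reflexive e─) ⊆∩ , (begin
    suc ∣ p ∣                       ≡⟨ cong suc (∣p─q∣+∣p∩q∣≡∣p∣ p s) ⟨
    suc (∣ p ─ s ∣ ℕ.+ ∣ p ∩ s ∣)   ≡⟨ ℕ.+-suc _ _ ⟨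
    ∣ p ─ s ∣ ℕ.+ suc ∣ p ∩ s ∣     ≡⟨ cong₂ ℕ._+_ (cong ∣_∣ e─) e∩ ⟩
    ∣ q ─ s ∣ ℕ.+ ∣ q ∩ s ∣         ≡⟨ ∣p─q∣+∣p∩q∣≡∣p∣ q s ⟩
    ∣ q ∣                           ∎)
    where open ≡-Reasoning

  ⋖-split : p ⋖ q → (p ─ s ⋖ q ─ s × p ∩ s ≡ q ∩ s) ⊎ (p ∩ s ⋖ q ∩ s × p ─ s ≡ q ─ s)
  ⋖-split (p⊆q , e) = Sum.map
    (λ (e─ , e∩) → (⊆─ , e─) , p⊆q∧∣q∣≤∣p∣⇒p≡q ⊆∩ (ℕ.≤-reflexive (sym e∩)))
    (λ (e─ , e∩) → (⊆∩ , e∩) , p⊆q∧∣q∣≤∣p∣⇒p≡q ⊆─ (ℕ.≤-reflexive (sym e─)))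
    (+-≡suc-split (p⊆q⇒∣p∣≤∣q∣ ⊆─) (p⊆q⇒∣p∣≤∣q∣ ⊆∩) sizes)
    where
    ⊆─ : p ─ s ⊆ q ─ s
    ⊆─ = ─-monoˡ-⊆ s p⊆q
    ⊆∩ : p ∩ s ⊆ q ∩ s
    ⊆∩ = ∩-monoˡ-⊆ s p⊆q
    sizes : ∣ q ─ s ∣ ℕ.+ ∣ q ∩ s ∣ ≡ suc (∣ p ─ s ∣ ℕ.+ ∣ p ∩ s ∣)
    sizes = trans (∣p─q∣+∣p∩q∣≡∣p∣ q s) (trans (sym e) (cong suc (sym (∣p─q∣+∣p∩q∣≡∣p∣ p s))))

  𝟙-⋖-split : 𝟙 (p ─ s ⋖? q ─ s) * δ (p ∩ s) (q ∩ s) + 𝟙 (p ∩ s ⋖? q ∩ s) * δ (p ─ s) (q ─ s)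
              ≡ 𝟙 (p ⋖? q)
  𝟙-⋖-split = trans (cong₂ _+_ (sym (𝟙-×-dec ⋖─? ≡∩?)) (sym (𝟙-×-dec ⋖∩? ≡─?)))
    (𝟙-+-disjoint (⋖─? ×-dec ≡∩?) (⋖∩? ×-dec ≡─?) (p ⋖? q)
      (λ (⋖─ , e∩) → ⋖-from-─ ⋖─ e∩) (λ (⋖∩ , e─) → ⋖-from-∩ ⋖∩ e─) ⋖-split
      (λ (⋖─ , _) (_ , e─) → ⋖-irrefl (subst (p ─ s ⋖_) (sym e─) ⋖─)))
    where
    ⋖─? = p ─ s ⋖? q ─ s
    ⋖∩? = p ∩ s ⋖? q ∩ s
    ≡─? = ≡-dec _≟ᵇ_ (p ─ s) (q ─ s)
    ≡∩? = ≡-dec _≟ᵇ_ (p ∩ s) (q ∩ s)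

-- Common covers

Adjacent : Subset n → Subset n → Set
Adjacent x y = ∣ y ∣ ≡ ∣ x ∣ × suc ∣ x ∩ y ∣ ≡ ∣ x ∣

adjacent? : (x y : Subset n) → Dec (Adjacent x y)
adjacent? x y = (∣ y ∣ ℕ.≟ ∣ x ∣) ×-dec (suc ∣ x ∩ y ∣ ℕ.≟ ∣ x ∣)

¬Adjacent-refl : (x : Subset n) → ¬ Adjacent x x
¬Adjacent-refl x (_ , e) = ℕ.1+n≢n (trans (cong (suc ∘ ∣_∣) (sym (∩-idem x))) e)

module _ {x y : Subset n} where

  Adjacent⇒⋖∪ : Adjacent x y → x ⋖ x ∪ y × y ⋖ x ∪ y
  Adjacent⇒⋖∪ (∣y∣≡∣x∣ , e) = (p⊆p∪q y , ∣x∪y∣) , (q⊆p∪q x y , trans (cong suc ∣y∣≡∣x∣) ∣x∪y∣)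
    where
    ∣x∪y∣ : suc ∣ x ∣ ≡ ∣ x ∪ y ∣
    ∣x∪y∣ = ℕ.+-cancelʳ-≡ (∣ x ∩ y ∣) (suc ∣ x ∣) (∣ x ∪ y ∣) (sym (begin
      ∣ x ∪ y ∣ ℕ.+ ∣ x ∩ y ∣    ≡⟨ ∣p∪q∣+∣p∩q∣≡∣p∣+∣q∣ x y ⟩
      ∣ x ∣ ℕ.+ ∣ y ∣            ≡⟨ cong₂ ℕ._+_ (sym e) ∣y∣≡∣x∣ ⟩
      suc ∣ x ∩ y ∣ ℕ.+ ∣ x ∣    ≡⟨ ℕ.+-comm (suc ∣ x ∩ y ∣) (∣ x ∣) ⟩
      ∣ x ∣ ℕ.+ suc ∣ x ∩ y ∣    ≡⟨ ℕ.+-suc (∣ x ∣) (∣ x ∩ y ∣) ⟩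
      suc ∣ x ∣ ℕ.+ ∣ x ∩ y ∣    ∎))
      where open ≡-Reasoning

  ⋖∪⇒Adjacent : x ⋖ x ∪ y × y ⋖ x ∪ y → Adjacent x y
  ⋖∪⇒Adjacent ((_ , ex) , (_ , ey)) = ∣y∣≡∣x∣ , ℕ.+-cancelˡ-≡ (∣ x ∣) (suc ∣ x ∩ y ∣) (∣ x ∣) (begin
      ∣ x ∣ ℕ.+ suc ∣ x ∩ y ∣    ≡⟨ ℕ.+-suc (∣ x ∣) (∣ x ∩ y ∣) ⟩
      suc ∣ x ∣ ℕ.+ ∣ x ∩ y ∣    ≡⟨ cong (ℕ._+ ∣ x ∩ y ∣) ex ⟩
      ∣ x ∪ y ∣ ℕ.+ ∣ x ∩ y ∣    ≡⟨ ∣p∪q∣+∣p∩q∣≡∣p∣+∣q∣ x y ⟩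
      ∣ x ∣ ℕ.+ ∣ y ∣            ≡⟨ cong (∣ x ∣ ℕ.+_) ∣y∣≡∣x∣ ⟩
      ∣ x ∣ ℕ.+ ∣ x ∣            ∎)
    where
    open ≡-Reasoning
    ∣y∣≡∣x∣ : ∣ y ∣ ≡ ∣ x ∣
    ∣y∣≡∣x∣ = ℕ.suc-injective (trans ey (sym ex))

  Adjacent⇒∩⋖ : Adjacent x y → x ∩ y ⋖ x × x ∩ y ⋖ y
  Adjacent⇒∩⋖ (∣y∣≡∣x∣ , e) = (p∩q⊆p x y , e) , (p∩q⊆q x y , trans e (sym ∣y∣≡∣x∣))

  ∩⋖⇒Adjacent : x ∩ y ⋖ x × x ∩ y ⋖ y → Adjacent x y
  ∩⋖⇒Adjacent ((_ , ex) , (_ , ey)) = trans (sym ey) ex , ex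

  common-upper-cover : x ≢ y → {z : Subset n} → x ⋖ z × y ⋖ z → z ≡ x ∪ y
  common-upper-cover x≢y {z} ((x⊆z , ex) , (y⊆z , ey)) with p⊆q⇒p≡q⊎∣p∣<∣q∣ (p⊆p∪q {p = x} y)
  ... | inj₁ x≡x∪y = contradiction (sym (p⊆q∧∣q∣≤∣p∣⇒p≡q y⊆x ∣x∣≤∣y∣)) x≢y
    where
    y⊆x = subst (y ⊆_) (sym x≡x∪y) (q⊆p∪q x y)
    ∣x∣≤∣y∣ = ℕ.≤-reflexive (ℕ.suc-injective (trans ex (sym ey)))
  ... | inj₂ ∣x∣<∣x∪y∣ =
    sym (p⊆q∧∣q∣≤∣p∣⇒p≡q (∪-least x⊆z y⊆z) (subst (ℕ._≤ ∣ x ∪ y ∣) ex ∣x∣<∣x∪y∣))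

  common-lower-cover : x ≢ y → {z : Subset n} → z ⋖ x × z ⋖ y → z ≡ x ∩ y
  common-lower-cover x≢y {z} ((z⊆x , ex) , (z⊆y , ey)) with p⊆q⇒p≡q⊎∣p∣<∣q∣ (p∩q⊆p x y)
  ... | inj₁ x∩y≡x = contradiction (p⊆q∧∣q∣≤∣p∣⇒p≡q x⊆y ∣y∣≤∣x∣) x≢y
    where
    x⊆y = subst (_⊆ y) x∩y≡x (p∩q⊆q x y)
    ∣y∣≤∣x∣ = ℕ.≤-reflexive (trans (sym ey) ex)
  ... | inj₂ ∣x∩y∣<∣x∣ =
    p⊆q∧∣q∣≤∣p∣⇒p≡q (∩-greatest z⊆x z⊆y)
      (ℕ.≤-pred (subst (suc ∣ x ∩ y ∣ ℕ.≤_) (sym ex) ∣x∩y∣<∣x∣))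

𝟙-∷⋖?∷ : (b : Bool) (p q : Subset n) → 𝟙 (b ∷ p ⋖? b ∷ q) ≡ 𝟙 (p ⋖? q)
𝟙-∷⋖?∷ inside  p q = 𝟙-cong (inside ∷ p ⋖? inside ∷ q) (p ⋖? q)
  (λ (h , e) → drop-∷-⊆ h , ℕ.suc-injective e) (λ (h , e) → s⊆s h , cong suc e)
𝟙-∷⋖?∷ outside p q = 𝟙-cong (outside ∷ p ⋖? outside ∷ q) (p ⋖? q)
  (λ (h , e) → drop-∷-⊆ h , e) (λ (h , e) → s⊆s h , e)

𝟙-out⋖?in : (p q : Subset n) → 𝟙 (outside ∷ p ⋖? inside ∷ q) ≡ δ p q
𝟙-out⋖?in p q = 𝟙-cong (outside ∷ p ⋖? inside ∷ q) (≡-dec _≟ᵇ_ p q)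
  (λ (h , e) → p⊆q∧∣q∣≤∣p∣⇒p≡q (drop-∷-⊆ h) (ℕ.≤-reflexive (sym (ℕ.suc-injective e))))
  (λ { refl → out⊆ ⊆-refl , refl })

𝟙-in⋖?out : (p q : Subset n) → 𝟙 (inside ∷ p ⋖? outside ∷ q) ≡ 0ℚ
𝟙-in⋖?out p q = 𝟙-no (inside ∷ p ⋖? outside ∷ q) (λ (h , _) → contradiction (h here) λ ())

upper-covers-count : (x : Subset n) → ∑Subsets (λ z → 𝟙 (x ⋖? z)) ≡ ℕ→ℚ n - ℕ→ℚ ∣ x ∣
upper-covers-count {zero}  []            = refl
upper-covers-count {suc n} (inside ∷ x)  = trans (∑Subsets-suc (λ z → 𝟙 (inside ∷ x ⋖? z))) (begin
  ∑Subsets (λ z → 𝟙 (inside ∷ x ⋖? inside ∷ z)) + ∑Subsets (λ z → 𝟙 (inside ∷ x ⋖? outside ∷ z))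
    ≡⟨ cong₂ _+_ (trans (∑-cong (allSubsets n) (𝟙-∷⋖?∷ inside x)) (upper-covers-count x))
                 (∑-zero (allSubsets n) (𝟙-in⋖?out x)) ⟩
  ℕ→ℚ n - ℕ→ℚ ∣ x ∣ + 0ℚ
    ≡⟨ solve 2 (λ m k → m :- k :+ con 0ℚ := (con 1ℚ :+ m) :- (con 1ℚ :+ k)) refl (ℕ→ℚ n) (ℕ→ℚ ∣ x ∣) ⟩
  (1ℚ + ℕ→ℚ n) - (1ℚ + ℕ→ℚ ∣ x ∣)
    ≡⟨ cong₂ _-_ (ℕ→ℚ-+ 1 n) (ℕ→ℚ-+ 1 ∣ x ∣) ⟨
  ℕ→ℚ (suc n) - ℕ→ℚ (suc ∣ x ∣) ∎)
  where open ≡-Reasoning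
upper-covers-count {suc n} (outside ∷ x) = trans (∑Subsets-suc (λ z → 𝟙 (outside ∷ x ⋖? z))) (begin
  ∑Subsets (λ z → 𝟙 (outside ∷ x ⋖? inside ∷ z)) + ∑Subsets (λ z → 𝟙 (outside ∷ x ⋖? outside ∷ z))
    ≡⟨ cong₂ _+_ (trans (∑-cong (allSubsets n) (𝟙-out⋖?in x)) (∑Subsets-δ x))
                 (trans (∑-cong (allSubsets n) (𝟙-∷⋖?∷ outside x)) (upper-covers-count x)) ⟩
  1ℚ + (ℕ→ℚ n - ℕ→ℚ ∣ x ∣)
    ≡⟨ solve 2 (λ m k → con 1ℚ :+ (m :- k) := (con 1ℚ :+ m) :- k) refl (ℕ→ℚ n) (ℕ→ℚ ∣ x ∣) ⟩
  (1ℚ + ℕ→ℚ n) - ℕ→ℚ ∣ x ∣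
    ≡⟨ cong (_- ℕ→ℚ ∣ x ∣) (ℕ→ℚ-+ 1 n) ⟨
  ℕ→ℚ (suc n) - ℕ→ℚ ∣ x ∣ ∎)
  where open ≡-Reasoning

lower-covers-count : (x : Subset n) → ∑Subsets (λ z → 𝟙 (z ⋖? x)) ≡ ℕ→ℚ ∣ x ∣
lower-covers-count {zero}  []            = refl
lower-covers-count {suc n} (inside ∷ x)  = trans (∑Subsets-suc (λ z → 𝟙 (z ⋖? inside ∷ x))) (begin
  ∑Subsets (λ z → 𝟙 (inside ∷ z ⋖? inside ∷ x)) + ∑Subsets (λ z → 𝟙 (outside ∷ z ⋖? inside ∷ x))
    ≡⟨ cong₂ _+_ (trans (∑-cong (allSubsets n) (λ z → 𝟙-∷⋖?∷ inside z x)) (lower-covers-count x))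
                 (trans (∑-cong (allSubsets n) (λ z → trans (𝟙-out⋖?in z x) (δ-comm z x))) (∑Subsets-δ x)) ⟩
  ℕ→ℚ ∣ x ∣ + 1ℚ
    ≡⟨ solve 1 (λ k → k :+ con 1ℚ := con 1ℚ :+ k) refl (ℕ→ℚ ∣ x ∣) ⟩
  1ℚ + ℕ→ℚ ∣ x ∣
    ≡⟨ ℕ→ℚ-+ 1 ∣ x ∣ ⟨
  ℕ→ℚ (suc ∣ x ∣) ∎)
  where open ≡-Reasoning
lower-covers-count {suc n} (outside ∷ x) = trans (∑Subsets-suc (λ z → 𝟙 (z ⋖? outside ∷ x))) (begin
  ∑Subsets (λ z → 𝟙 (inside ∷ z ⋖? outside ∷ x)) + ∑Subsets (λ z → 𝟙 (outside ∷ z ⋖? outside ∷ x))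
    ≡⟨ cong₂ _+_ (∑-zero (allSubsets n) (λ z → 𝟙-in⋖?out z x))
                 (trans (∑-cong (allSubsets n) (λ z → 𝟙-∷⋖?∷ outside z x)) (lower-covers-count x)) ⟩
  0ℚ + ℕ→ℚ ∣ x ∣
    ≡⟨ +-identityˡ _ ⟩
  ℕ→ℚ ∣ x ∣ ∎)
  where open ≡-Reasoning

δ-cases : (x y : Subset n) {f c a : ℚ} → (x ≡ y → f ≡ c) → (x ≡ y → a ≡ 0ℚ) → (x ≢ y → f ≡ a) →
          f ≡ δ x y * c + a
δ-cases x y {c = c} {a} on a≡0 off with ≡-dec _≟ᵇ_ x y
... | yes x≡y = trans (on x≡y) (sym (trans (cong₂ _+_ (*-identityˡ c) (a≡0 x≡y)) (+-identityʳ c)))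
... | no x≢y  = trans (off x≢y) (sym (trans (cong (_+ a) (*-zeroˡ c)) (+-identityˡ a)))

∑-common-upper-covers : (x y : Subset n) →
  ∑Subsets (λ z → 𝟙 (x ⋖? z) * 𝟙 (y ⋖? z)) ≡ δ x y * (ℕ→ℚ n - ℕ→ℚ ∣ x ∣) + 𝟙 (adjacent? x y)
∑-common-upper-covers {n} x y = δ-cases x y
  (λ { refl → trans (∑-cong (allSubsets n) (λ z → 𝟙-idem (x ⋖? z))) (upper-covers-count x) })
  (λ { refl → 𝟙-no (adjacent? x x) (¬Adjacent-refl x) })
  (λ x≢y → trans (∑-cong (allSubsets n) (λ z → sym (𝟙-×-dec (x ⋖? z) (y ⋖? z))))
    (∑Subsets-𝟙-unique (λ z → (x ⋖? z) ×-dec (y ⋖? z)) (adjacent? x y) (x ∪ y)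
      (common-upper-cover x≢y) ⋖∪⇒Adjacent Adjacent⇒⋖∪))

∑-common-lower-covers : (x y : Subset n) →
  ∑Subsets (λ z → 𝟙 (z ⋖? x) * 𝟙 (z ⋖? y)) ≡ δ x y * ℕ→ℚ ∣ x ∣ + 𝟙 (adjacent? x y)
∑-common-lower-covers {n} x y = δ-cases x y
  (λ { refl → trans (∑-cong (allSubsets n) (λ z → 𝟙-idem (z ⋖? x))) (lower-covers-count x) })
  (λ { refl → 𝟙-no (adjacent? x x) (¬Adjacent-refl x) })
  (λ x≢y → trans (∑-cong (allSubsets n) (λ z → sym (𝟙-×-dec (z ⋖? x) (z ⋖? y))))
    (∑Subsets-𝟙-unique (λ z → (z ⋖? x) ×-dec (z ⋖? y)) (adjacent? x y) (x ∩ y)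
      (common-lower-cover x≢y) ∩⋖⇒Adjacent Adjacent⇒∩⋖))

-- The sl₂-modules ℂ^{2^S} and their tensor product

Supported : Subset n → LC (Subset n) → Set
Supported S l = All (λ e → proj₂ e ⊆ S) l

Supported-map : {S : Subset n} {Q : Subset n → Set} {l : LC (Subset n)} →
                (∀ {u} → u ⊆ S → Q u) → Supported S l → All (Q ∘ proj₂) l
Supported-map f = All.map f

-- The operators of 'SL2 S' act on all subsets of Fin D; ℂ^{2^S} is the span of the subsets of S.
Stable : Subset n → Op (Subset n) → Set
Stable S f = ∀ {u} → u ⊆ S → Supported S (f u)

supported-sumBasis-filter : {S : Subset n} {P : Subset n → Set} (P? : Decidable P) →
                            (∀ {v} → P v → v ⊆ S) → Supported S (sumBasis (filter P? (allSubsets n)))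
supported-sumBasis-filter {n} P? P⇒⊆ = map⁺ (All.map P⇒⊆ (all-filter P? (allSubsets n)))

module _ {D : ℕ} (S : Subset D) where
  open SL2 S

  coeff-Eₛ : (u v : Subset D) → coeff (Eₛ u) v ≡ 𝟙 (v ⋖? u)
  coeff-Eₛ u v = coeff-filter (_⋖? u) v

  coeff-Fₛ : (u v : Subset D) → v ⊆ S → coeff (Fₛ u) v ≡ 𝟙 (u ⋖? v)
  coeff-Fₛ u v v⊆S = trans (coeff-filter F? v)
    (𝟙-cong (F? v) (u ⋖? v) (λ (_ , u⊆v , e) → u⊆v , sym e) (λ (u⊆v , e) → v⊆S , u⊆v , sym e))
    where
    F? = λ w → (w ⊆? S) ×-dec ((u ⊆? w) ×-dec (∣ w ∣ ℕ.≟ suc ∣ u ∣))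

  coeff-Hₛ : (u v : Subset D) → coeff (Hₛ u) v ≡ (ℕ→ℚ ∣ S ∣ - ℕ→ℚ (2 ℕ.* ∣ u ∣)) * δ u v
  coeff-Hₛ u v = coeff-singleton _ u v

  Eₛ-stable : {S′ : Subset D} → Stable S′ Eₛ
  Eₛ-stable u⊆S′ = supported-sumBasis-filter (_⋖? _) (λ (v⊆u , _) → ⊆-trans v⊆u u⊆S′)

  Fₛ-stable : Stable S Fₛ
  Fₛ-stable _ = supported-sumBasis-filter _ proj₁

  Hₛ-stable : {S′ : Subset D} → Stable S′ Hₛ
  Hₛ-stable u⊆S′ = u⊆S′ ∷ []

¼ : ℚ
¼ = ℤ.+ 1 / 4

module Transport {D : ℕ} (s : Subset D) where
  open Hahn s
  open SL2 (∁ s) using () renaming (Eₛ to E₁; Fₛ to F₁; Hₛ to H₁)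
  open SL2 s     using () renaming (Eₛ to E₂; Fₛ to F₂; Hₛ to H₂)

  matrix : Op T → Subset D → Subset D → ℚ
  matrix f x y = coeff (transport f x) y

  matrix≡⟪⟫ : (f : Op T) (x y : Subset D) → matrix f x y ≡ ⟪ f (ι x) , (λ b → δ (ι⁻¹ b) y) ⟫
  matrix≡⟪⟫ f x y = trans (coeff≡⟪⟫ (transport f x) y) (⟪⟫-mapBasis ι⁻¹ (f (ι x)) _)

  matrix-⊕ : (f g : Op T) (x y : Subset D) → matrix (f ⊕ g) x y ≡ matrix f x y + matrix g x y
  matrix-⊕ f g x y = begin
    matrix (f ⊕ g) x y                    ≡⟨ matrix≡⟪⟫ (f ⊕ g) x y ⟩
    ⟪ f (ι x) ++ g (ι x) , δ̂ ⟫           ≡⟨ ⟪⟫-++ (f (ι x)) (g (ι x)) δ̂ ⟩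
    ⟪ f (ι x) , δ̂ ⟫ + ⟪ g (ι x) , δ̂ ⟫   ≡⟨ cong₂ _+_ (matrix≡⟪⟫ f x y) (matrix≡⟪⟫ g x y) ⟨
    matrix f x y + matrix g x y           ∎
    where
    open ≡-Reasoning
    δ̂ = λ b → δ (ι⁻¹ b) y

  matrix-· : (c : ℚ) (f : Op T) (x y : Subset D) → matrix (c · f) x y ≡ c * matrix f x y
  matrix-· c f x y = trans (matrix≡⟪⟫ (c · f) x y)
    (trans (⟪⟫-scale c (f (ι x)) _) (cong (c *_) (sym (matrix≡⟪⟫ f x y))))

  δ-∪ : {u w : Subset D} → u ⊆ ∁ s → w ⊆ s → (y : Subset D) → δ (u ∪ w) y ≡ δ u (y ─ s) * δ w (y ∩ s)
  δ-∪ {u} {w} u⊆ w⊆ y = trans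
    (𝟙-cong (≡-dec _≟ᵇ_ (u ∪ w) y) (≡-dec _≟ᵇ_ u (y ─ s) ×-dec ≡-dec _≟ᵇ_ w (y ∩ s))
      (λ { refl → sym (∪-─-cancel u⊆ w⊆) , sym (∪-∩-cancel u⊆ w⊆) })
      (λ { (refl , refl) → p─q∪p∩q≡p y s }))
    (𝟙-×-dec (≡-dec _≟ᵇ_ u (y ─ s)) (≡-dec _≟ᵇ_ w (y ∩ s)))

  δ-split : (x y : Subset D) → δ x y ≡ δ (x ─ s) (y ─ s) * δ (x ∩ s) (y ∩ s)
  δ-split x y = trans (cong (λ z → δ z y) (sym (p─q∪p∩q≡p x s))) (δ-∪ (p─q⊆∁q x s) (p∩q⊆q x s) y)

  matrix-⊗1 : (f : Op (Subset D)) → Stable (∁ s) f → (x y : Subset D) →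
              matrix (f ⊗1) x y ≡ coeff (f (x ─ s)) (y ─ s) * δ (x ∩ s) (y ∩ s)
  matrix-⊗1 f f-stable x y = begin
    matrix (f ⊗1) x y
      ≡⟨ matrix≡⟪⟫ (f ⊗1) x y ⟩
    ⟪ mapBasis (λ u → (u , x ∩ s)) (f (x ─ s)) , (λ b → δ (ι⁻¹ b) y) ⟫
      ≡⟨ ⟪⟫-mapBasis _ (f (x ─ s)) _ ⟩
    ⟪ f (x ─ s) , (λ u → δ (u ∪ (x ∩ s)) y) ⟫
      ≡⟨ ⟪⟫-cong (f (x ─ s)) (Supported-map (λ u⊆ → δ-∪ u⊆ (p∩q⊆q x s) y) (f-stable (p─q⊆∁q x s))) ⟩
    ⟪ f (x ─ s) , (λ u → δ u (y ─ s) * δ (x ∩ s) (y ∩ s)) ⟫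
      ≡⟨ ⟪⟫-*ʳ (f (x ─ s)) _ _ ⟩
    ⟪ f (x ─ s) , (λ u → δ u (y ─ s)) ⟫ * δ (x ∩ s) (y ∩ s)
      ≡⟨ cong (_* δ (x ∩ s) (y ∩ s)) (coeff≡⟪⟫ (f (x ─ s)) (y ─ s)) ⟨
    coeff (f (x ─ s)) (y ─ s) * δ (x ∩ s) (y ∩ s) ∎
    where open ≡-Reasoning

  matrix-1⊗ : (g : Op (Subset D)) → Stable s g → (x y : Subset D) →
              matrix (1⊗ g) x y ≡ coeff (g (x ∩ s)) (y ∩ s) * δ (x ─ s) (y ─ s)
  matrix-1⊗ g g-stable x y = begin
    matrix (1⊗ g) x y
      ≡⟨ matrix≡⟪⟫ (1⊗ g) x y ⟩
    ⟪ mapBasis (λ w → (x ─ s , w)) (g (x ∩ s)) , (λ b → δ (ι⁻¹ b) y) ⟫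
      ≡⟨ ⟪⟫-mapBasis _ (g (x ∩ s)) _ ⟩
    ⟪ g (x ∩ s) , (λ w → δ ((x ─ s) ∪ w) y) ⟫
      ≡⟨ ⟪⟫-cong (g (x ∩ s)) (Supported-map δ-∪′ (g-stable (p∩q⊆q x s))) ⟩
    ⟪ g (x ∩ s) , (λ w → δ w (y ∩ s) * δ (x ─ s) (y ─ s)) ⟫
      ≡⟨ ⟪⟫-*ʳ (g (x ∩ s)) _ _ ⟩
    ⟪ g (x ∩ s) , (λ w → δ w (y ∩ s)) ⟫ * δ (x ─ s) (y ─ s)
      ≡⟨ cong (_* δ (x ─ s) (y ─ s)) (coeff≡⟪⟫ (g (x ∩ s)) (y ∩ s)) ⟨
    coeff (g (x ∩ s)) (y ∩ s) * δ (x ─ s) (y ─ s) ∎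
    where
    open ≡-Reasoning
    δ-∪′ : {w : Subset D} → w ⊆ s → δ ((x ─ s) ∪ w) y ≡ δ w (y ∩ s) * δ (x ─ s) (y ─ s)
    δ-∪′ {w} w⊆ = trans (δ-∪ (p─q⊆∁q x s) w⊆ y) (*-comm (δ (x ─ s) (y ─ s)) (δ w (y ∩ s)))

  InImage : T → Set
  InImage b = ι (ι⁻¹ b) ≡ b

  -- ι⁻¹ is inverse to ι only on pairs (u , w) with u ⊆ ∁ s and w ⊆ s.
  matrix-∘ : (f g : Op T) (x y : Subset D) → All (InImage ∘ proj₂) (g (ι x)) →
             matrix (f ∘ₒ g) x y ≡ ∑Subsets (λ z → matrix g x z * matrix f z y)
  matrix-∘ f g x y g-in-image = begin
    matrix (f ∘ₒ g) x y
      ≡⟨ matrix≡⟪⟫ (f ∘ₒ g) x y ⟩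
    ⟪ bind f (g (ι x)) , δ̂ y ⟫
      ≡⟨ ⟪⟫-bind f (g (ι x)) (δ̂ y) ⟩
    ⟪ g (ι x) , (λ b → ⟪ f b , δ̂ y ⟫) ⟫
      ≡⟨ ⟪⟫-cong (g (ι x)) (All.map f-on-image g-in-image) ⟩
    ⟪ g (ι x) , (λ b → matrix f (ι⁻¹ b) y) ⟫
      ≡⟨ ⟪⟫-cong (g (ι x)) (All.universal (λ (_ , b) → sym (∑Subsets-δˡ (ι⁻¹ b) (λ z → matrix f z y))) _) ⟩
    ⟪ g (ι x) , (λ b → ∑Subsets (λ z → δ (ι⁻¹ b) z * matrix f z y)) ⟫
      ≡⟨ ⟪⟫-∑ (g (ι x)) (allSubsets D) _ ⟩
    ∑Subsets (λ z → ⟪ g (ι x) , (λ b → δ (ι⁻¹ b) z * matrix f z y) ⟫)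
      ≡⟨ ∑-cong (allSubsets D) (λ z →
           trans (⟪⟫-*ʳ (g (ι x)) _ _) (cong (_* matrix f z y) (sym (matrix≡⟪⟫ g x z)))) ⟩
    ∑Subsets (λ z → matrix g x z * matrix f z y) ∎
    where
    f-on-image : {b : T} → InImage b → ⟪ f b , (λ b′ → δ (ι⁻¹ b′) y) ⟫ ≡ matrix f (ι⁻¹ b) y
    f-on-image ιι⁻¹b≡b =
      trans (cong (λ b → ⟪ f b , (λ b′ → δ (ι⁻¹ b′) y) ⟫) (sym ιι⁻¹b≡b)) (sym (matrix≡⟪⟫ f _ y))
    open ≡-Reasoning
    δ̂ = λ y b → δ (ι⁻¹ b) y

  ⊗-in-image : (f g : Op (Subset D)) → Stable (∁ s) f → Stable s g → (x : Subset D) →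
               All (InImage ∘ proj₂) (((f ⊗1) ⊕ (1⊗ g)) (ι x))
  ⊗-in-image f g f-stable g-stable x = ++⁺
    (map⁺ (Supported-map (λ u⊆ → ι∘ι⁻¹ u⊆ (p∩q⊆q x s)) (f-stable (p─q⊆∁q x s))))
    (map⁺ (Supported-map (λ w⊆ → ι∘ι⁻¹ (p─q⊆∁q x s) w⊆) (g-stable (p∩q⊆q x s))))
    where
    ι∘ι⁻¹ : {u w : Subset D} → u ⊆ ∁ s → w ⊆ s → InImage (u , w)
    ι∘ι⁻¹ u⊆ w⊆ = cong₂ _,_ (∪-─-cancel u⊆ w⊆) (∪-∩-cancel u⊆ w⊆)

  weight₁ weight₂ weight : Subset D → ℚ
  weight₁ x = ℕ→ℚ ∣ ∁ s ∣ - ℕ→ℚ (2 ℕ.* ∣ x ─ s ∣)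
  weight₂ x = ℕ→ℚ ∣ s ∣ - ℕ→ℚ (2 ℕ.* ∣ x ∩ s ∣)
  weight x = weight₁ x + weight₂ x

  module _ (x y : Subset D) where
    open ≡-Reasoning

    matrix-H₁ : matrix (H₁ ⊗1) x y ≡ weight₁ x * δ x y
    matrix-H₁ = begin
      matrix (H₁ ⊗1) x y
        ≡⟨ matrix-⊗1 H₁ (Hₛ-stable (∁ s)) x y ⟩
      coeff (H₁ (x ─ s)) (y ─ s) * δ (x ∩ s) (y ∩ s)
        ≡⟨ cong (_* δ (x ∩ s) (y ∩ s)) (coeff-Hₛ (∁ s) (x ─ s) (y ─ s)) ⟩
      weight₁ x * δ (x ─ s) (y ─ s) * δ (x ∩ s) (y ∩ s)
        ≡⟨ *-assoc (weight₁ x) _ _ ⟩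
      weight₁ x * (δ (x ─ s) (y ─ s) * δ (x ∩ s) (y ∩ s))
        ≡⟨ cong (weight₁ x *_) (δ-split x y) ⟨
      weight₁ x * δ x y ∎

    matrix-H₂ : matrix (1⊗ H₂) x y ≡ weight₂ x * δ x y
    matrix-H₂ = begin
      matrix (1⊗ H₂) x y
        ≡⟨ matrix-1⊗ H₂ (Hₛ-stable s) x y ⟩
      coeff (H₂ (x ∩ s)) (y ∩ s) * δ (x ─ s) (y ─ s)
        ≡⟨ cong (_* δ (x ─ s) (y ─ s)) (coeff-Hₛ s (x ∩ s) (y ∩ s)) ⟩
      weight₂ x * δ (x ∩ s) (y ∩ s) * δ (x ─ s) (y ─ s)
        ≡⟨ *-assoc (weight₂ x) _ _ ⟩
      weight₂ x * (δ (x ∩ s) (y ∩ s) * δ (x ─ s) (y ─ s))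
        ≡⟨ cong (weight₂ x *_) (*-comm (δ (x ∩ s) (y ∩ s)) (δ (x ─ s) (y ─ s))) ⟩
      weight₂ x * (δ (x ─ s) (y ─ s) * δ (x ∩ s) (y ∩ s))
        ≡⟨ cong (weight₂ x *_) (δ-split x y) ⟨
      weight₂ x * δ x y ∎

    matrix-ΔH : matrix ΔH x y ≡ weight x * δ x y
    matrix-ΔH = trans (matrix-⊕ (H₁ ⊗1) (1⊗ H₂) x y)
      (trans (cong₂ _+_ matrix-H₁ matrix-H₂) (sym (*-distribʳ-+ (δ x y) (weight₁ x) (weight₂ x))))

    matrix-ΔE : matrix ΔE x y ≡ 𝟙 (y ⋖? x)
    matrix-ΔE = begin
      matrix ΔE x y
        ≡⟨ matrix-⊕ (E₁ ⊗1) (1⊗ E₂) x y ⟩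
      matrix (E₁ ⊗1) x y + matrix (1⊗ E₂) x y
        ≡⟨ cong₂ _+_ (matrix-⊗1 E₁ (Eₛ-stable (∁ s)) x y) (matrix-1⊗ E₂ (Eₛ-stable s) x y) ⟩
      coeff (E₁ (x ─ s)) (y ─ s) * δ (x ∩ s) (y ∩ s) + coeff (E₂ (x ∩ s)) (y ∩ s) * δ (x ─ s) (y ─ s)
        ≡⟨ cong₂ _+_ (cong₂ _*_ (coeff-Eₛ (∁ s) (x ─ s) (y ─ s)) (δ-comm (x ∩ s) (y ∩ s)))
                     (cong₂ _*_ (coeff-Eₛ s (x ∩ s) (y ∩ s)) (δ-comm (x ─ s) (y ─ s))) ⟩
      𝟙 (y ─ s ⋖? x ─ s) * δ (y ∩ s) (x ∩ s) + 𝟙 (y ∩ s ⋖? x ∩ s) * δ (y ─ s) (x ─ s)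
        ≡⟨ 𝟙-⋖-split s {y} {x} ⟩
      𝟙 (y ⋖? x) ∎

    matrix-ΔF : matrix ΔF x y ≡ 𝟙 (x ⋖? y)
    matrix-ΔF = begin
      matrix ΔF x y
        ≡⟨ matrix-⊕ (F₁ ⊗1) (1⊗ F₂) x y ⟩
      matrix (F₁ ⊗1) x y + matrix (1⊗ F₂) x y
        ≡⟨ cong₂ _+_ (matrix-⊗1 F₁ (Fₛ-stable (∁ s)) x y) (matrix-1⊗ F₂ (Fₛ-stable s) x y) ⟩
      coeff (F₁ (x ─ s)) (y ─ s) * δ (x ∩ s) (y ∩ s) + coeff (F₂ (x ∩ s)) (y ∩ s) * δ (x ─ s) (y ─ s)
        ≡⟨ cong₂ _+_ (cong (_* δ (x ∩ s) (y ∩ s)) (coeff-Fₛ (∁ s) (x ─ s) (y ─ s) (p─q⊆∁q y s)))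
                     (cong (_* δ (x ─ s) (y ─ s)) (coeff-Fₛ s (x ∩ s) (y ∩ s) (p∩q⊆q y s))) ⟩
      𝟙 (x ─ s ⋖? y ─ s) * δ (x ∩ s) (y ∩ s) + 𝟙 (x ∩ s ⋖? y ∩ s) * δ (x ─ s) (y ─ s)
        ≡⟨ 𝟙-⋖-split s {x} {y} ⟩
      𝟙 (x ⋖? y) ∎

  ΔE-in-image : (x : Subset D) → All (InImage ∘ proj₂) (ΔE (ι x))
  ΔE-in-image = ⊗-in-image E₁ E₂ (Eₛ-stable (∁ s)) (Eₛ-stable s)

  ΔF-in-image : (x : Subset D) → All (InImage ∘ proj₂) (ΔF (ι x))
  ΔF-in-image = ⊗-in-image F₁ F₂ (Fₛ-stable (∁ s)) (Fₛ-stable s)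

  ΔH-in-image : (x : Subset D) → All (InImage ∘ proj₂) (ΔH (ι x))
  ΔH-in-image = ⊗-in-image H₁ H₂ (Hₛ-stable (∁ s)) (Hₛ-stable s)

  module _ (x y : Subset D) where
    open ≡-Reasoning

    matrix-ΔEΔF : matrix (ΔE ∘ₒ ΔF) x y ≡ δ x y * (ℕ→ℚ D - ℕ→ℚ ∣ x ∣) + 𝟙 (adjacent? x y)
    matrix-ΔEΔF = begin
      matrix (ΔE ∘ₒ ΔF) x y
        ≡⟨ matrix-∘ ΔE ΔF x y (ΔF-in-image x) ⟩
      ∑Subsets (λ z → matrix ΔF x z * matrix ΔE z y)
        ≡⟨ ∑-cong (allSubsets D) (λ z → cong₂ _*_ (matrix-ΔF x z) (matrix-ΔE z y)) ⟩
      ∑Subsets (λ z → 𝟙 (x ⋖? z) * 𝟙 (y ⋖? z))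
        ≡⟨ ∑-common-upper-covers x y ⟩
      δ x y * (ℕ→ℚ D - ℕ→ℚ ∣ x ∣) + 𝟙 (adjacent? x y) ∎

    matrix-ΔFΔE : matrix (ΔF ∘ₒ ΔE) x y ≡ δ x y * ℕ→ℚ ∣ x ∣ + 𝟙 (adjacent? x y)
    matrix-ΔFΔE = begin
      matrix (ΔF ∘ₒ ΔE) x y
        ≡⟨ matrix-∘ ΔF ΔE x y (ΔE-in-image x) ⟩
      ∑Subsets (λ z → matrix ΔE x z * matrix ΔF z y)
        ≡⟨ ∑-cong (allSubsets D) (λ z → cong₂ _*_ (matrix-ΔE x z) (matrix-ΔF z y)) ⟩
      ∑Subsets (λ z → 𝟙 (z ⋖? x) * 𝟙 (z ⋖? y))
        ≡⟨ ∑-common-lower-covers x y ⟩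
      δ x y * ℕ→ℚ ∣ x ∣ + 𝟙 (adjacent? x y) ∎

    matrix-ΔHΔH : matrix (ΔH ∘ₒ ΔH) x y ≡ weight x * (weight x * δ x y)
    matrix-ΔHΔH = begin
      matrix (ΔH ∘ₒ ΔH) x y
        ≡⟨ matrix-∘ ΔH ΔH x y (ΔH-in-image x) ⟩
      ∑Subsets (λ z → matrix ΔH x z * matrix ΔH z y)
        ≡⟨ ∑-cong (allSubsets D) (λ z → cong₂ _*_ (matrix-ΔH x z) (matrix-ΔH z y)) ⟩
      ∑Subsets (λ z → weight x * δ x z * (weight z * δ z y))
        ≡⟨ ∑-cong (allSubsets D) (λ z → solve 4 (λ a d b e → a :* d :* (b :* e) := d :* (a :* (b :* e)))
                                                 refl (weight x) (δ x z) (weight z) (δ z y)) ⟩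
      ∑Subsets (λ z → δ x z * (weight x * (weight z * δ z y)))
        ≡⟨ ∑Subsets-δˡ x (λ z → weight x * (weight z * δ z y)) ⟩
      weight x * (weight x * δ x y) ∎

    matrix-♮A : matrix ♮A x y ≡ ¼ * (weight₁ x - weight₂ x) * δ x y
    matrix-♮A = begin
      matrix ♮A x y
        ≡⟨ matrix-· ¼ ((H₁ ⊗1) ⊕ (- 1ℚ) · (1⊗ H₂)) x y ⟩
      ¼ * matrix ((H₁ ⊗1) ⊕ (- 1ℚ) · (1⊗ H₂)) x y
        ≡⟨ cong (¼ *_) (trans (matrix-⊕ (H₁ ⊗1) ((- 1ℚ) · (1⊗ H₂)) x y)
                              (cong (matrix (H₁ ⊗1) x y +_) (matrix-· (- 1ℚ) (1⊗ H₂) x y))) ⟩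
      ¼ * (matrix (H₁ ⊗1) x y + - 1ℚ * matrix (1⊗ H₂) x y)
        ≡⟨ cong₂ (λ a b → ¼ * (a + - 1ℚ * b)) (matrix-H₁ x y) (matrix-H₂ x y) ⟩
      ¼ * (weight₁ x * δ x y + - 1ℚ * (weight₂ x * δ x y))
        ≡⟨ solve 3 (λ a b d → con ¼ :* (a :* d :+ con (- 1ℚ) :* (b :* d)) := con ¼ :* (a :- b) :* d)
                 refl (weight₁ x) (weight₂ x) (δ x y) ⟩
      ¼ * (weight₁ x - weight₂ x) * δ x y ∎

    matrix-♮B : matrix ♮B x y ≡ (ℕ→ℚ D * ½ + weight x * weight x * ¼) * δ x y + 𝟙 (adjacent? x y)
    matrix-♮B = begin
      matrix ♮B x y
        ≡⟨ matrix-· ½ (ΔE ∘ₒ ΔF ⊕ ΔF ∘ₒ ΔE ⊕ ½ · (ΔH ∘ₒ ΔH)) x y ⟩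
      ½ * matrix (ΔE ∘ₒ ΔF ⊕ ΔF ∘ₒ ΔE ⊕ ½ · (ΔH ∘ₒ ΔH)) x y
        ≡⟨ cong (½ *_) (trans (matrix-⊕ (ΔE ∘ₒ ΔF ⊕ ΔF ∘ₒ ΔE) (½ · (ΔH ∘ₒ ΔH)) x y)
                              (cong₂ _+_ (matrix-⊕ (ΔE ∘ₒ ΔF) (ΔF ∘ₒ ΔE) x y) (matrix-· ½ (ΔH ∘ₒ ΔH) x y))) ⟩
      ½ * (matrix (ΔE ∘ₒ ΔF) x y + matrix (ΔF ∘ₒ ΔE) x y + ½ * matrix (ΔH ∘ₒ ΔH) x y)
        ≡⟨ cong₂ (λ a b → ½ * (a + b)) (cong₂ _+_ matrix-ΔEΔF matrix-ΔFΔE) (cong (½ *_) matrix-ΔHΔH) ⟩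
      ½ * (δ x y * (ℕ→ℚ D - ℕ→ℚ ∣ x ∣) + 𝟙 (adjacent? x y) + (δ x y * ℕ→ℚ ∣ x ∣ + 𝟙 (adjacent? x y))
           + ½ * (weight x * (weight x * δ x y)))
        ≡⟨ solve 5 (λ d N X a e → con ½ :* ((d :* (N :- X) :+ a) :+ (d :* X :+ a) :+ con ½ :* (e :* (e :* d)))
                               := (N :* con ½ :+ e :* e :* con ¼) :* d :+ a)
                 refl (δ x y) (ℕ→ℚ D) (ℕ→ℚ ∣ x ∣) (𝟙 (adjacent? x y)) (weight x) ⟩
      (ℕ→ℚ D * ½ + weight x * weight x * ¼) * δ x y + 𝟙 (adjacent? x y) ∎

  module _ (x : Subset D) where
    open ≡-Reasoning

    private
      ∁s♯ s♯ x─s♯ x∩s♯ s─x♯ : ℚ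
      ∁s♯ = ℕ→ℚ ∣ ∁ s ∣
      s♯ = ℕ→ℚ ∣ s ∣
      x─s♯ = ℕ→ℚ ∣ x ─ s ∣
      x∩s♯ = ℕ→ℚ ∣ x ∩ s ∣
      s─x♯ = ℕ→ℚ ∣ s ─ x ∣

      ∁s♯+s♯≡D : ∁s♯ + s♯ ≡ ℕ→ℚ D
      ∁s♯+s♯≡D = trans (sym (ℕ→ℚ-+ ∣ ∁ s ∣ ∣ s ∣)) (cong ℕ→ℚ (∣∁p∣+∣p∣≡n s))

      x─s♯+x∩s♯≡∣x∣ : x─s♯ + x∩s♯ ≡ ℕ→ℚ ∣ x ∣
      x─s♯+x∩s♯≡∣x∣ =
        trans (sym (ℕ→ℚ-+ ∣ x ─ s ∣ ∣ x ∩ s ∣)) (cong ℕ→ℚ (∣p─q∣+∣p∩q∣≡∣p∣ x s))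

      s♯≡s─x♯+x∩s♯ : s♯ ≡ s─x♯ + x∩s♯
      s♯≡s─x♯+x∩s♯ = trans
        (cong ℕ→ℚ (trans (sym (∣p─q∣+∣p∩q∣≡∣p∣ s x)) (cong (λ t → ∣ s ─ x ∣ ℕ.+ ∣ t ∣) (∩-comm s x))))
        (ℕ→ℚ-+ ∣ s ─ x ∣ ∣ x ∩ s ∣)

    weight≡D-2∣x∣ : weight x ≡ (ℤ.+ D ℤ.- ℤ.+ (2 ℕ.* ∣ x ∣)) / 1
    weight≡D-2∣x∣ = begin
      (∁s♯ - ℕ→ℚ (2 ℕ.* ∣ x ─ s ∣)) + (s♯ - ℕ→ℚ (2 ℕ.* ∣ x ∩ s ∣))
        ≡⟨ cong₂ (λ a b → (∁s♯ - a) + (s♯ - b)) (ℕ→ℚ-2* ∣ x ─ s ∣) (ℕ→ℚ-2* ∣ x ∩ s ∣) ⟩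
      (∁s♯ - (x─s♯ + x─s♯)) + (s♯ - (x∩s♯ + x∩s♯))
        ≡⟨ solve 4 (λ c t r q → (c :- (r :+ r)) :+ (t :- (q :+ q)) := (c :+ t) :- ((r :+ q) :+ (r :+ q)))
                 refl ∁s♯ s♯ x─s♯ x∩s♯ ⟩
      (∁s♯ + s♯) - ((x─s♯ + x∩s♯) + (x─s♯ + x∩s♯))
        ≡⟨ cong₂ (λ a b → a - (b + b)) ∁s♯+s♯≡D x─s♯+x∩s♯≡∣x∣ ⟩
      ℕ→ℚ D - (ℕ→ℚ ∣ x ∣ + ℕ→ℚ ∣ x ∣)
        ≡⟨ cong (_-_ (ℕ→ℚ D)) (ℕ→ℚ-2* ∣ x ∣) ⟨
      ℕ→ℚ D - ℕ→ℚ (2 ℕ.* ∣ x ∣)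
        ≡⟨ [+m-+k]/1 D (2 ℕ.* ∣ x ∣) ⟨
      (ℤ.+ D ℤ.- ℤ.+ (2 ℕ.* ∣ x ∣)) / 1 ∎

    A-eigenvalue : ¼ * (weight₁ x - weight₂ x) ≡ ℕ→ℚ D * ¼ - ℕ→ℚ (∣ s ─ x ∣ ℕ.+ ∣ x ─ s ∣) * ½
    A-eigenvalue = begin
      ¼ * ((∁s♯ - ℕ→ℚ (2 ℕ.* ∣ x ─ s ∣)) - (s♯ - ℕ→ℚ (2 ℕ.* ∣ x ∩ s ∣)))
        ≡⟨ cong₂ (λ a b → ¼ * ((∁s♯ - a) - (s♯ - b))) (ℕ→ℚ-2* ∣ x ─ s ∣) (ℕ→ℚ-2* ∣ x ∩ s ∣) ⟩
      ¼ * ((∁s♯ - (x─s♯ + x─s♯)) - (s♯ - (x∩s♯ + x∩s♯)))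
        ≡⟨ cong (λ t → ¼ * ((∁s♯ - (x─s♯ + x─s♯)) - (t - (x∩s♯ + x∩s♯)))) s♯≡s─x♯+x∩s♯ ⟩
      ¼ * ((∁s♯ - (x─s♯ + x─s♯)) - ((s─x♯ + x∩s♯) - (x∩s♯ + x∩s♯)))
        ≡⟨ solve 4 (λ c r q p → con ¼ :* ((c :- (r :+ r)) :- ((p :+ q) :- (q :+ q)))
                               := (c :+ (p :+ q)) :* con ¼ :- (p :+ r) :* con ½) refl ∁s♯ x─s♯ x∩s♯ s─x♯ ⟩
      (∁s♯ + (s─x♯ + x∩s♯)) * ¼ - (s─x♯ + x─s♯) * ½
        ≡⟨ cong₂ (λ a b → a * ¼ - b * ½) (trans (cong (∁s♯ +_) (sym s♯≡s─x♯+x∩s♯)) ∁s♯+s♯≡D)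
                                          (sym (ℕ→ℚ-+ ∣ s ─ x ∣ ∣ x ─ s ∣)) ⟩
      ℕ→ℚ D * ¼ - ℕ→ℚ (∣ s ─ x ∣ ℕ.+ ∣ x ─ s ∣) * ½ ∎

theorem5p8 : (D : ℕ) (x₀ x : Subset D) →
    ((y : Subset D) →
      coeff (Hahn.actA x₀ x) y
        ≡ coeff ((ℕ→ℚ D * (ℤ.+ 1 / 4) - ℕ→ℚ (∣ x₀ ─ x ∣ ℕ.+ ∣ x ─ x₀ ∣) * (ℤ.+ 1 / 2) , x) ∷ []) y)
    × ((y : Subset D) →
      coeff (Hahn.actB x₀ x) y
        ≡ coeff ((ℕ→ℚ D * (ℤ.+ 1 / 2) + ((ℤ.+ D ℤ.- ℤ.+ (2 ℕ.* ∣ x ∣)) / 1) * ((ℤ.+ D ℤ.- ℤ.+ (2 ℕ.* ∣ x ∣)) / 1) * (ℤ.+ 1 / 4) , x)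
                 ∷ sumBasis (filter (λ z → (∣ z ∣ ℕ.≟ ∣ x ∣) ×-dec (suc ∣ x ∩ z ∣ ℕ.≟ ∣ x ∣)) (allSubsets D))) y)
theorem5p8 D x₀ x = (λ y → begin
    matrix (Hahn.♮A x₀) x y
      ≡⟨ matrix-♮A x y ⟩
    ¼ * (weight₁ x - weight₂ x) * δ x y
      ≡⟨ cong (_* δ x y) (A-eigenvalue x) ⟩
    a * δ x y
      ≡⟨ coeff-singleton a x y ⟨
    coeff ((a , x) ∷ []) y ∎)
  , (λ y → begin
    matrix (Hahn.♮B x₀) x y
      ≡⟨ matrix-♮B x y ⟩
    (ℕ→ℚ D * ½ + weight x * weight x * ¼) * δ x y + 𝟙 (adjacent? x y)
      ≡⟨ cong (λ e → (ℕ→ℚ D * ½ + e * e * ¼) * δ x y + 𝟙 (adjacent? x y)) (weight≡D-2∣x∣ x) ⟩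
    b * δ x y + 𝟙 (adjacent? x y)
      ≡⟨ cong (b * δ x y +_) (coeff-filter (adjacent? x) y) ⟨
    b * δ x y + coeff adjacents y
      ≡⟨ coeff-∷ b x adjacents y ⟨
    coeff ((b , x) ∷ adjacents) y ∎)
  where
  open Transport x₀
  open ≡-Reasoning
  a b : ℚ
  a = ℕ→ℚ D * ¼ - ℕ→ℚ (∣ x₀ ─ x ∣ ℕ.+ ∣ x ─ x₀ ∣) * ½
  b = ℕ→ℚ D * ½ + (ℤ.+ D ℤ.- ℤ.+ (2 ℕ.* ∣ x ∣)) / 1 * ((ℤ.+ D ℤ.- ℤ.+ (2 ℕ.* ∣ x ∣)) / 1) * ¼
  adjacents : LC (Subset D)
  adjacents = sumBasis (filter (adjacent? x) (allSubsets D))
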